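{- Let $G$ be an edge-colored graph of order $n$ such that $\delta^c(G)=n-1$ (so $G$ is complete). For any subset $S$ of $V(G)$ with $|S|=5$, $G[S]$ contains a rainbow $C_4$.
   Context: Graphs are finite and simple. An edge-colored graph is a graph $G$ with a map $C:E(G)\to\mathbb{N}$. The color degree $d^c(v)$ is the number of distinct colors on edges incident to $v$, and $\delta^c(G)=\min_v d^c(v)$. $G[S]$ is the induced subgraph on $S$. A subgraph is rainbow if all its edges have distinct colors; $C_4$ is a cycle of length 4. -}

module Defs where

open import Data.Nat using (ℕ; _∸_)
open import Data.Nat.Properties using () renaming (_≟_ to _≟ℕ_)
open import Data.Bool using (Bool; true; false)
import Data.Bool
open import Data.Fin using (Fin)
open import Data.Fin.Subset using (Subset; _∈_; ∣_∣)
open import Data.List using (List; length; map; filter; deduplicate; allFin)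
open import Data.Product using (Σ; _×_; ∃-syntax)
open import Relation.Binary.PropositionalEquality using (_≡_; _≢_)

-- A finite simple graph on vertex set Fin n together with an edge colouring.
-- adj is the (symmetric, irreflexive) adjacency relation; colour u v is the
-- colour of the edge uv (its value on non-edges is irrelevant).
record EdgeColoredGraph (n : ℕ) : Set where
  field
    adj     : Fin n → Fin n → Bool
    adj-sym : ∀ u v → adj u v ≡ adj v u
    adj-irr : ∀ v → adj v v ≡ false
    colour  : Fin n → Fin n → ℕ
    colour-sym : ∀ u v → colour u v ≡ colour v u

module _ {n : ℕ} (G : EdgeColoredGraph n) where
  open EdgeColoredGraph G

  Edge : Fin n → Fin n → Set
  Edge u v = adj u v ≡ true

  neighbours : Fin n → List (Fin n)
  neighbours v = filter (λ u → Data.Bool._≟_ (adj v u) true) (allFin n)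

  colourDegree : Fin n → ℕ
  colourDegree v = length (deduplicate _≟ℕ_ (map (colour v) (neighbours v)))

  MinColourDegreeIs : ℕ → Set
  MinColourDegreeIs k = ∀ v → colourDegree v ≡ k

  HasRainbowC4In : Subset n → Set
  HasRainbowC4In S =
    ∃[ a ] ∃[ b ] ∃[ c ] ∃[ d ]
      ((a ∈ S) × (b ∈ S) × (c ∈ S) × (d ∈ S))
    × ((a ≢ b) × (a ≢ c) × (a ≢ d) × (b ≢ c) × (b ≢ d) × (c ≢ d))
    × (Edge a b × Edge b c × Edge c d × Edge d a)
    × (colour a b ≢ colour b c × colour a b ≢ colour c d × colour a b ≢ colour d a
       × colour b c ≢ colour c d × colour b c ≢ colour d a × colour c d ≢ colour d a)

-- Colour degree n − 1 leaves no room: each vertex has at most n − 1 neighbours,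
-- so it is adjacent to all other vertices and its incident edges carry pairwise
-- distinct colours. In a properly coloured complete graph a 4-cycle is rainbow
-- as soon as neither of its two perfect matchings is monochromatic. Four
-- vertices a, b, c, d carry three perfect matchings; if at most one is
-- monochromatic, the other two form a rainbow 4-cycle. If two are, say
-- c(ab) = c(cd) and c(ac) = c(bd), the fifth vertex e gives the rainbow
-- 4-cycle e b a c: c(eb) ≠ c(bd) = c(ac) and c(ba) = c(cd) ≠ c(ce) by
-- properness at b and at c.

module Submission where

open import Defs
open import Data.Nat using (ℕ; _∸_)
open import Data.Fin.Subset using (Subset; ∣_∣)
open import Relation.Binary.PropositionalEquality using (_≡_)

open import Data.Bool using (true; false)
import Data.Bool as Bool
open import Data.Nat using (suc; _+_; _≤_; _<_; s≤s)
open import Data.Nat.Properties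
  using (≤-trans; <-≤-trans; ≤-<-trans; ≤-reflexive; m≤n⇒m≤1+n; 1+n≰n; +-monoʳ-≤)
  renaming (_≟_ to _≟ℕ_)
open import Data.Fin using (Fin; zero; suc; _≟_; #_)
open import Data.Fin.Properties using (suc-injective)
open import Data.Fin.Subset using (_∈_)
import Data.Vec.Base as Vec
open import Data.Vec.Base using (Vec; lookup)
import Data.Vec.Relation.Unary.All as VAll
import Data.Vec.Relation.Unary.All.Properties as VAllP
import Data.Vec.Relation.Unary.AllPairs as VAllPairs
open import Data.Vec.Relation.Unary.Unique.Propositional using (Unique)
import Data.Vec.Relation.Unary.Unique.Propositional.Properties as Unique
open import Data.List.Base using (List; []; _∷_; length; map; filter; deduplicate; allFin)
open import Data.List.Properties using (length-filter; filter-notAll; length-map; length-tabulate; length-deduplicate)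
open import Data.List.Membership.Propositional using (lose) renaming (_∈_ to _∈ₗ_)
open import Data.List.Membership.Propositional.Properties using (∈-map⁺; ∈-filter⁺; ∈-deduplicate⁺; ∈-allFin)
open import Data.List.Relation.Unary.Any using (Any; here; there)
open import Data.List.Relation.Unary.AllPairs using ([]; _∷_)
open import Data.List.Relation.Unary.All using ([]; _∷_)
open import Data.List.Relation.Unary.Unique.DecPropositional (_≟_ {5}) using (unique?)
open import Data.Product using (Σ; _×_; _,_; ∃-syntax)
open import Function using (_∘_; Injective)
open import Relation.Nullary using (¬_; ¬?; yes; no; does; contradiction)
open import Relation.Nullary.Decidable using (True; toWitness; decidable-stable)
open import Relation.Binary.PropositionalEquality using (_≢_; refl; sym; trans; subst)
open import Relation.Binary.Definitions using (DecidableEquality)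
open import Relation.Unary using (Decidable; ∁)

private
  variable
    n k : ℕ

elements : (p : Subset n) → Vec (Fin n) ∣ p ∣
elements Vec.[] = Vec.[]
elements (true Vec.∷ p) = zero Vec.∷ Vec.map suc (elements p)
elements (false Vec.∷ p) = Vec.map suc (elements p)

elements-unique : (p : Subset n) → Unique (elements p)
elements-unique Vec.[] = VAllPairs.[]
elements-unique (true Vec.∷ p) =
  VAllP.map⁺ (VAll.universal (λ _ ()) (elements p)) VAllPairs.∷ Unique.map⁺ suc-injective (elements-unique p)
elements-unique (false Vec.∷ p) = Unique.map⁺ suc-injective (elements-unique p)

elements-⊆ : (p : Subset n) → VAll.All (_∈ p) (elements p)
elements-⊆ Vec.[] = VAll.[]
elements-⊆ (true Vec.∷ p) = Vec.here VAll.∷ VAllP.map⁺ (VAll.map Vec.there (elements-⊆ p))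
elements-⊆ (false Vec.∷ p) = VAllP.map⁺ (VAll.map Vec.there (elements-⊆ p))

∣p∣≡k⇒enumeration : (p : Subset n) → ∣ p ∣ ≡ k →
                    Σ (Fin k → Fin n) λ v → Injective _≡_ _≡_ v × (∀ i → v i ∈ p)
∣p∣≡k⇒enumeration p refl =
  lookup (elements p) , Unique.lookup-injective (elements-unique p) _ _ , VAllP.lookup⁺ (elements-⊆ p)

module _ {A : Set} {P : A → Set} (P? : Decidable P) where

  filter-notAll₂ : ∀ {xs x y} → x ∈ₗ xs → y ∈ₗ xs → x ≢ y → ¬ P x → ¬ P y →
                   2 + length (filter P? xs) ≤ length xs
  filter-notAll₂ (here refl) (here refl) x≢y _ _ = contradiction refl x≢y
  filter-notAll₂ {x ∷ xs} (here refl) (there y∈xs) _ ¬px ¬py with P? x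
  ... | yes px = contradiction px ¬px
  ... | no _   = s≤s (filter-notAll P? xs (lose y∈xs ¬py))
  filter-notAll₂ (there x∈xs) (here refl) x≢y ¬px ¬py =
    filter-notAll₂ (here refl) (there x∈xs) (x≢y ∘ sym) ¬py ¬px
  filter-notAll₂ {z ∷ xs} (there x∈xs) (there y∈xs) x≢y ¬px ¬py
    with ih ← filter-notAll₂ x∈xs y∈xs x≢y ¬px ¬py | does (P? z)
  ... | true  = s≤s ih
  ... | false = m≤n⇒m≤1+n ih

module _ {A B : Set} (_≟ᴮ_ : DecidableEquality B) (f : A → B) where

  length-deduplicate-map : ∀ xs → length (deduplicate _≟ᴮ_ (map f xs)) ≤ length xs
  length-deduplicate-map xs =
    ≤-trans (length-deduplicate _≟ᴮ_ (map f xs)) (≤-reflexive (length-map f xs))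

  length-deduplicate-map< : ∀ {xs x y} → x ∈ₗ xs → y ∈ₗ xs → x ≢ y → f x ≡ f y →
                            length (deduplicate _≟ᴮ_ (map f xs)) < length xs
  length-deduplicate-map< (here refl) (here refl) x≢y _ = contradiction refl x≢y
  length-deduplicate-map< {x ∷ xs} (here refl) (there y∈xs) _ fx≡fy =
    s≤s (<-≤-trans (filter-notAll (¬? ∘ (f x ≟ᴮ_)) _ fy-rejected)
                   (length-deduplicate-map xs))
    where
    fy-rejected : Any (∁ (¬_ ∘ (f x ≡_))) (deduplicate _≟ᴮ_ (map f xs))
    fy-rejected = lose (∈-deduplicate⁺ _≟ᴮ_ (∈-map⁺ f y∈xs)) (λ fx≢fy → fx≢fy fx≡fy)
  length-deduplicate-map< (there x∈xs) (here refl) x≢y fx≡fy =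
    length-deduplicate-map< (here refl) (there x∈xs) (x≢y ∘ sym) (sym fx≡fy)
  length-deduplicate-map< {z ∷ xs} (there x∈xs) (there y∈xs) x≢y fx≡fy =
    s≤s (≤-<-trans (length-filter (¬? ∘ (f z ≟ᴮ_)) (deduplicate _≟ᴮ_ (map f xs)))
                   (length-deduplicate-map< x∈xs y∈xs x≢y fx≡fy))

2+[n∸1]≰n : ∀ n → ¬ 2 + (n ∸ 1) ≤ n
2+[n∸1]≰n 0 ()
2+[n∸1]≰n (suc n) = 1+n≰n

module _ (G : EdgeColoredGraph n) where
  open EdgeColoredGraph G

  adjacent? : ∀ v → Decidable (Edge G v)
  adjacent? v u = adj v u Bool.≟ true

  degree : Fin n → ℕ
  degree v = length (neighbours G v)

  colourDegree≤degree : ∀ v → colourDegree G v ≤ degree v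
  colourDegree≤degree v = length-deduplicate-map _≟ℕ_ (colour v) (neighbours G v)

  ¬Edge-refl : ∀ v → ¬ Edge G v v
  ¬Edge-refl v e with trans (sym (adj-irr v)) e
  ... | ()

  non-edge⇒2+degree≤n : ∀ {u v} → u ≢ v → ¬ Edge G v u → 2 + degree v ≤ n
  non-edge⇒2+degree≤n {u} {v} u≢v ¬vu =
    subst (2 + degree v ≤_) (length-tabulate (λ i → i))
      (filter-notAll₂ (adjacent? v) (∈-allFin u) (∈-allFin v) u≢v ¬vu (¬Edge-refl v))

  1+degree≤n : ∀ v → 1 + degree v ≤ n
  1+degree≤n v =
    subst (1 + degree v ≤_) (length-tabulate (λ i → i))
      (filter-notAll (adjacent? v) (allFin n) (lose (∈-allFin v) (¬Edge-refl v)))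

  colour-clash⇒colourDegree<degree : ∀ {v u w} → Edge G v u → Edge G v w → u ≢ w →
                                     colour v u ≡ colour v w → colourDegree G v < degree v
  colour-clash⇒colourDegree<degree {v} {u} {w} vu vw =
    length-deduplicate-map< _≟ℕ_ (colour v)
      (∈-filter⁺ (adjacent? v) (∈-allFin u) vu) (∈-filter⁺ (adjacent? v) (∈-allFin w) vw)

  record ProperCompleteColouring : Set where
    field
      complete : ∀ {u v} → u ≢ v → Edge G u v
      proper   : ∀ {v u w} → u ≢ v → w ≢ v → u ≢ w → colour v u ≢ colour v w

  minColourDegree⇒properComplete : MinColourDegreeIs G (n ∸ 1) → ProperCompleteColouring
  minColourDegree⇒properComplete δᶜ≡n∸1 = record { complete = complete ; proper = proper }
    where
    2+colourDegree≰n : ∀ v → ¬ 2 + colourDegree G v ≤ n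
    2+colourDegree≰n v = 2+[n∸1]≰n n ∘ subst (λ d → 2 + d ≤ n) (δᶜ≡n∸1 v)

    complete : ∀ {u v} → u ≢ v → Edge G u v
    complete {u} {v} u≢v = decidable-stable (adjacent? u v) λ ¬uv →
      2+colourDegree≰n u (≤-trans (+-monoʳ-≤ 2 (colourDegree≤degree u))
                                   (non-edge⇒2+degree≤n (u≢v ∘ sym) ¬uv))

    proper : ∀ {v u w} → u ≢ v → w ≢ v → u ≢ w → colour v u ≢ colour v w
    proper {v} u≢v w≢v u≢w clash =
      2+colourDegree≰n v (≤-trans (s≤s (colour-clash⇒colourDegree<degree
                                          (complete (u≢v ∘ sym)) (complete (w≢v ∘ sym)) u≢w clash))
                                  (1+degree≤n v))

module _ {G : EdgeColoredGraph n} (K : ProperCompleteColouring G) where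
  open EdgeColoredGraph G
  open ProperCompleteColouring K

  path-colours-differ : ∀ {a b c} → a ≢ b → b ≢ c → a ≢ c → colour a b ≢ colour b c
  path-colours-differ a≢b b≢c a≢c ab≡bc =
    proper a≢b (b≢c ∘ sym) a≢c (trans (colour-sym _ _) ab≡bc)

  rainbow-cycle : ∀ {S a b c d} → a ∈ S → b ∈ S → c ∈ S → d ∈ S →
                  a ≢ b → a ≢ c → a ≢ d → b ≢ c → b ≢ d → c ≢ d →
                  colour a b ≢ colour c d → colour a d ≢ colour b c → HasRainbowC4In G S
  rainbow-cycle {a = a} {d = d} a∈S b∈S c∈S d∈S a≢b a≢c a≢d b≢c b≢d c≢d ab≢cd ad≢bc =
    _ , _ , _ , _ , (a∈S , b∈S , c∈S , d∈S) , (a≢b , a≢c , a≢d , b≢c , b≢d , c≢d) ,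
    (complete a≢b , complete b≢c , complete c≢d , complete (a≢d ∘ sym)) ,
    ( path-colours-differ a≢b b≢c a≢c
    , ab≢cd
    , path-colours-differ (a≢d ∘ sym) a≢b (b≢d ∘ sym) ∘ sym
    , path-colours-differ b≢c c≢d b≢d
    , (λ bc≡da → ad≢bc (trans (colour-sym a d) (sym bc≡da)))
    , path-colours-differ c≢d (a≢d ∘ sym) (a≢c ∘ sym))

  module _ {S : Subset n} (v : Fin 5 → Fin n) (v-injective : Injective _≡_ _≡_ v)
           (v∈S : ∀ i → v i ∈ S) where

    -- Decided by computation, so for the literal indices a … e below the
    -- implicit Distinct arguments are solved by unification.
    Distinct : List (Fin 5) → Set
    Distinct is = True (unique? is)

    χ : Fin 5 → Fin 5 → ℕ
    χ i j = colour (v i) (v j)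

    χ-sym : ∀ i j → χ i j ≡ χ j i
    χ-sym i j = colour-sym (v i) (v j)

    v-distinct : ∀ {i j} → i ≢ j → v i ≢ v j
    v-distinct i≢j = i≢j ∘ v-injective

    χ-path : ∀ i j k {_ : Distinct (i ∷ j ∷ k ∷ [])} → χ i j ≢ χ j k
    χ-path i j k {d} with toWitness d
    ... | (i≢j ∷ i≢k ∷ []) ∷ (j≢k ∷ []) ∷ [] ∷ [] =
      path-colours-differ (v-distinct i≢j) (v-distinct j≢k) (v-distinct i≢k)

    χ-cycle : ∀ i j k l {_ : Distinct (i ∷ j ∷ k ∷ l ∷ [])} →
              χ i j ≢ χ k l → χ i l ≢ χ j k → HasRainbowC4In G S
    χ-cycle i j k l {d} with toWitness d
    ... | (i≢j ∷ i≢k ∷ i≢l ∷ []) ∷ (j≢k ∷ j≢l ∷ []) ∷ (k≢l ∷ []) ∷ [] ∷ [] =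
      rainbow-cycle (v∈S i) (v∈S j) (v∈S k) (v∈S l)
        (v-distinct i≢j) (v-distinct i≢k) (v-distinct i≢l)
        (v-distinct j≢k) (v-distinct j≢l) (v-distinct k≢l)

    a b c d e : Fin 5
    a = # 0
    b = # 1
    c = # 2
    d = # 3
    e = # 4

    five-vertices-rainbowC4 : HasRainbowC4In G S
    five-vertices-rainbowC4 with χ a b ≟ℕ χ c d | χ a c ≟ℕ χ b d | χ a d ≟ℕ χ b c
    ... | no ab≢cd | _        | no ad≢bc = χ-cycle a b c d ab≢cd ad≢bc
    ... | no ab≢cd | no ac≢bd | _        = χ-cycle a b d c (ab≢cd ∘ λ q → trans q (χ-sym d c)) ac≢bd
    ... | _        | no ac≢bd | no ad≢bc = χ-cycle a c b d ac≢bd (ad≢bc ∘ λ q → trans q (χ-sym c b))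
    ... | yes ab≡cd | yes ac≡bd | _ =
      χ-cycle e b a c (χ-path e b d ∘ λ q → trans q ac≡bd)
                      (χ-path e c d ∘ λ q → trans q (trans (χ-sym b a) ab≡cd))
    ... | yes ab≡cd | _ | yes ad≡bc =
      χ-cycle e b a d (χ-path e b c ∘ λ q → trans q ad≡bc)
                      (χ-path e d c ∘ λ q → trans q (trans (χ-sym b a) (trans ab≡cd (χ-sym c d))))
    ... | _ | yes ac≡bd | yes ad≡bc =
      χ-cycle e c a d (χ-path e c b ∘ λ q → trans q (trans ad≡bc (χ-sym b c)))
                      (χ-path e d b ∘ λ q → trans q (trans (χ-sym c a) (trans ac≡bd (χ-sym b d))))

lemma10 : (n : ℕ) (G : EdgeColoredGraph n)
          → MinColourDegreeIs G (n ∸ 1)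
          → (S : Subset n) → ∣ S ∣ ≡ 5
          → HasRainbowC4In G S
lemma10 n G δᶜ≡n∸1 S ∣S∣≡5 =
  let v , v-injective , v∈S = ∣p∣≡k⇒enumeration S ∣S∣≡5
  in five-vertices-rainbowC4 (minColourDegree⇒properComplete G δᶜ≡n∸1) v v-injective v∈S
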